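{- Let $h\ge0$ and let $\rho,\rho'$ be $h$-prefix bisimilar traces of $K$. Then for all traces $\rho_L,\rho_R$ of $K$ such that $\rho_L\star\rho$ and $\rho\star\rho_R$ are defined: (1) $\rho_L\star\rho$ and $\rho_L\star\rho'$ are $h$-prefix bisimilar; (2) $\rho\star\rho_R$ and $\rho'\star\rho_R$ are $h$-prefix bisimilar.
   Context: $K=(AP,S,R,\mu,s_0)$ is a Kripke structure over a finite set $AP$ ($R\subseteq S\times S$, $\mu:S\to 2^{AP}$). A trace is a nonempty finite word $\rho$ over $S$ with $(\rho(i),\rho(i+1))\in R$ for all $i<|\rho|$; $\rho(i,j)=\rho(i)\cdots\rho(j)$; $\mu(\rho)=\mu(\rho(1))\cdots\mu(\rho(|\rho|))$; if $\rho(|\rho|)=\rho'(1)$ then $\rho\star\rho'=\rho(1,|\rho|-1)\cdot\rho'$. $\mathsf{spec}=\{r_1,\dots,r_H\}$ is a finite set of regular expressions over $AP$ ($r::=\varepsilon\mid\phi\mid r\cup r\mid r\cdot r\mid r^*$, $\phi$ propositional over $AP$). For each $\ell$, $\mathcal A_\ell=(2^{AP},Q_\ell,Q^0_\ell,\Delta_\ell,F_\ell)$ is the canonical complete NFA accepting $\mathcal L(r_\ell)$, the $Q_\ell$ pairwise disjoint. The summary of a trace is $\mathcal S(\rho)=(\rho(1),\Pi,\rho(|\rho|))$, where $\Pi$ is the set of pairs $(q,q')$ with $q,q'\in Q_\ell$ for some $\ell$ such that some run of $\mathcal A_\ell$ over $\mu(\rho)$ goes from $q$ to $q'$. Two traces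 $\rho,\rho'$ are $0$-prefix bisimilar iff $\mathcal S(\rho)=\mathcal S(\rho')$; for $h>0$, they are $h$-prefix bisimilar iff $\mathcal S(\rho)=\mathcal S(\rho')$ and for each proper prefix $\nu$ of $\rho$ (resp. $\nu'$ of $\rho'$) there is a proper prefix $\nu'$ of $\rho'$ (resp. $\nu$ of $\rho$) such that $\nu,\nu'$ are $(h-1)$-prefix bisimilar. -}

module Defs where

open import Data.Nat using (ℕ; zero; suc)
open import Data.Fin using (Fin)
open import Data.Bool using (Bool; true; false; T; not; _∧_; _∨_)
open import Data.Vec using (Vec; lookup)
open import Data.List using (List; []; _∷_; _++_; map)
open import Data.List.NonEmpty using (List⁺; _∷_; toList; head; _++⁺_)
open import Data.Product using (Σ; ∃; _×_; _,_)
open import Data.Unit using (⊤)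
open import Relation.Binary.PropositionalEquality using (_≡_)
open import Function.Bundles using (_⇔_)

-- Atomic propositions AP = Fin nAP; a letter of 2^AP is a subset of AP.

Letter : ℕ → Set
Letter n = Vec Bool n

data PForm (n : ℕ) : Set where
  atom : Fin n → PForm n
  ptrue pfalse : PForm n
  pneg : PForm n → PForm n
  pand por : PForm n → PForm n → PForm n

_⊨_ : {n : ℕ} → Letter n → PForm n → Bool
a ⊨ atom p = lookup a p
a ⊨ ptrue = true
a ⊨ pfalse = false
a ⊨ pneg φ = not (a ⊨ φ)
a ⊨ pand φ ψ = (a ⊨ φ) ∧ (a ⊨ ψ)
a ⊨ por φ ψ = (a ⊨ φ) ∨ (a ⊨ ψ)

data Regex (n : ℕ) : Set where
  eps : Regex n
  lit : PForm n → Regex n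
  _∪_ _·_ : Regex n → Regex n → Regex n
  _* : Regex n → Regex n

data _∈L_ {n : ℕ} : List (Letter n) → Regex n → Set where
  in-eps : [] ∈L eps
  in-lit : ∀ {a φ} → T (a ⊨ φ) → (a ∷ []) ∈L lit φ
  in-∪ˡ : ∀ {w r s} → w ∈L r → w ∈L (r ∪ s)
  in-∪ʳ : ∀ {w r s} → w ∈L s → w ∈L (r ∪ s)
  in-· : ∀ {u v r s} → u ∈L r → v ∈L s → (u ++ v) ∈L (r · s)
  in-*0 : ∀ {r} → [] ∈L (r *)
  in-*S : ∀ {u v r} → u ∈L r → v ∈L (r *) → (u ++ v) ∈L (r *)

record NFA (n : ℕ) : Set where
  field
    size : ℕ
    Q0   : Fin size → Bool
    Δ    : Fin size → Letter n → Fin size → Bool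
    F    : Fin size → Bool
open NFA public

data Run {n : ℕ} (A : NFA n) : List (Letter n) → Fin (size A) → Fin (size A) → Set where
  run-nil  : ∀ {q} → Run A [] q q
  run-cons : ∀ {q a q₁ w q₂} → T (Δ A q a q₁) → Run A w q₁ q₂ → Run A (a ∷ w) q q₂

Accepts : {n : ℕ} → NFA n → List (Letter n) → Set
Accepts A w = Σ (Fin (size A)) λ q → Σ (Fin (size A)) λ q' →
  T (Q0 A q) × T (F A q') × Run A w q q'

Complete : {n : ℕ} → NFA n → Set
Complete A = ∀ q a → Σ (Fin (size A)) λ q' → T (Δ A q a q')

Recognizes : {n : ℕ} → NFA n → Regex n → Set
Recognizes A r = ∀ w → Accepts A w ⇔ (w ∈L r)

record Kripke : Set where
  field
    nAP : ℕ
    nS  : ℕ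
    R   : Fin nS → Fin nS → Bool
    μ   : Fin nS → Letter nAP
    s0  : Fin nS
open Kripke public

-- A Kripke structure together with spec = {r_1..r_H} and, for each ℓ,
-- a complete NFA A_ℓ accepting L(r_ℓ).  (State sets are disjoint by
-- construction: a state of A_ℓ is tagged by its index ℓ.)
record Setting : Set where
  field
    K    : Kripke
    H    : ℕ
    spec : Fin H → Regex (nAP K)
    aut  : Fin H → NFA (nAP K)
    aut-complete   : ∀ ℓ → Complete (aut ℓ)
    aut-recognizes : ∀ ℓ → Recognizes (aut ℓ) (spec ℓ)
open Setting public

Word : Setting → Set
Word M = List⁺ (Fin (nS (K M)))

finalL : {A : Set} → A → List A → A
finalL x [] = x
finalL x (y ∷ xs) = finalL y xs

final : {A : Set} → List⁺ A → A
final (x ∷ xs) = finalL x xs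

dropLastL : {A : Set} → A → List A → List A
dropLastL x [] = []
dropLastL x (y ∷ xs) = x ∷ dropLastL y xs

dropLast : {A : Set} → List⁺ A → List A
dropLast (x ∷ xs) = dropLastL x xs

-- ρ ⋆ ρ' = ρ(1,|ρ|-1) · ρ'  (meaningful when final ρ ≡ head ρ')
_⋆_ : {A : Set} → List⁺ A → List⁺ A → List⁺ A
ρ ⋆ ρ' = dropLast ρ ++⁺ ρ'

Chain : (M : Setting) → List (Fin (nS (K M))) → Set
Chain M [] = ⊤
Chain M (x ∷ []) = ⊤
Chain M (x ∷ y ∷ xs) = T (R (K M) x y) × Chain M (y ∷ xs)

IsTrace : (M : Setting) → Word M → Set
IsTrace M ρ = Chain M (toList ρ)

μword : (M : Setting) → Word M → List (Letter (nAP (K M)))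
μword M ρ = map (μ (K M)) (toList ρ)

-- Π(ρ), as a predicate: (ℓ, q, q') ∈ Π(ρ) iff some run of A_ℓ over μ(ρ) goes from q to q'
InΠ : (M : Setting) → Word M → (ℓ : Fin (H M)) → Fin (size (aut M ℓ)) → Fin (size (aut M ℓ)) → Set
InΠ M ρ ℓ q q' = Run (aut M ℓ) (μword M ρ) q q'

SameSummary : (M : Setting) → Word M → Word M → Set
SameSummary M ρ ρ' =
  (head ρ ≡ head ρ') × (final ρ ≡ final ρ') ×
  (∀ ℓ q q' → InΠ M ρ ℓ q q' ⇔ InΠ M ρ' ℓ q q')

ProperPrefix : (M : Setting) → Word M → Word M → Set
ProperPrefix M ν ρ = Σ (Word M) λ w → (toList ν ++ toList w) ≡ toList ρ

PBisim : (M : Setting) → ℕ → Word M → Word M → Set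
PBisim M zero ρ ρ' = SameSummary M ρ ρ'
PBisim M (suc h) ρ ρ' =
  SameSummary M ρ ρ' ×
  (∀ ν → ProperPrefix M ν ρ → Σ (Word M) λ ν' → ProperPrefix M ν' ρ' × PBisim M h ν ν') ×
  (∀ ν' → ProperPrefix M ν' ρ' → Σ (Word M) λ ν → ProperPrefix M ν ρ × PBisim M h ν ν')

module Submission where

-- A run of an automaton over a concatenation splits at an intermediate state, so the
-- run relation of u · w is determined by those of u and w; hence equal summaries are
-- preserved by extension on either side. Prefix bisimilarity is then a congruence for
-- both extensions by induction on h: a proper prefix of u · ρ is either a prefix of u,
-- matched by itself, or u · ν with ν a proper prefix of ρ, matched through ρ ~ ρ'; a
-- proper prefix of ρ · v is either a proper prefix of ρ or ρ · m, matched by ρ' · m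
-- using the congruence at level h − 1.

open import Defs
open import Data.Nat using (ℕ; zero; suc)
open import Data.Fin using (Fin)
open import Data.List using (List; []; _∷_; _++_; map)
open import Data.List.Properties using (map-++; ++-assoc; ∷-injective)
open import Data.List.NonEmpty using (List⁺; _∷_; head; tail; toList; _++⁺_; _⁺++_)
open import Data.Product using (Σ; _×_; _,_)
open import Data.Sum using (_⊎_; inj₁; inj₂)
open import Function.Bundles using (_⇔_; mk⇔; Equivalence)
open import Function.Construct.Identity using (⇔-id)
open import Relation.Binary.PropositionalEquality
  using (_≡_; refl; sym; trans; cong; subst₂; module ≡-Reasoning)

module _ {n : ℕ} (A : NFA n) where

  Run-++ : ∀ {u v q m q'} → Run A u q m → Run A v m q' → Run A (u ++ v) q q'
  Run-++ run-nil r = r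
  Run-++ (run-cons t r₁) r = run-cons t (Run-++ r₁ r)

  Run-++⁻ : ∀ u {v q q'} → Run A (u ++ v) q q' →
    Σ (Fin (size A)) λ m → Run A u q m × Run A v m q'
  Run-++⁻ [] r = _ , run-nil , r
  Run-++⁻ (a ∷ u) (run-cons t r) with Run-++⁻ u r
  ... | m , r₁ , r₂ = m , run-cons t r₁ , r₂

  RunEquivalent : List (Letter n) → List (Letter n) → Set
  RunEquivalent w w' = ∀ q q' → Run A w q q' ⇔ Run A w' q q'

  RunEquivalent-refl : ∀ w → RunEquivalent w w
  RunEquivalent-refl w q q' = ⇔-id _

  RunEquivalent-++ : ∀ {u u' v v'} → RunEquivalent u u' → RunEquivalent v v' →
    RunEquivalent (u ++ v) (u' ++ v')
  RunEquivalent-++ {u} {u'} eu ev q q' = mk⇔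
    (λ r → let m , r₁ , r₂ = Run-++⁻ u r in
           Run-++ (Equivalence.to (eu q m) r₁) (Equivalence.to (ev m q') r₂))
    (λ r → let m , r₁ , r₂ = Run-++⁻ u' r in
           Run-++ (Equivalence.from (eu q m) r₁) (Equivalence.from (ev m q') r₂))

++-≡-++-split : ∀ {A : Set} (a b c d : List A) → a ++ b ≡ c ++ d →
  (Σ (List A) λ m → c ≡ a ++ m × b ≡ m ++ d) ⊎
  (Σ A λ y → Σ (List A) λ ys → a ≡ c ++ y ∷ ys × d ≡ (y ∷ ys) ++ b)
++-≡-++-split [] b c d eq = inj₁ (c , refl , eq)
++-≡-++-split (x ∷ a) b [] d eq = inj₂ (x , a , refl , sym eq)
++-≡-++-split (x ∷ a) b (y ∷ c) d eq with ∷-injective eq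
... | refl , eq' with ++-≡-++-split a b c d eq'
... | inj₁ (m , e₁ , e₂) = inj₁ (m , cong (x ∷_) e₁ , e₂)
... | inj₂ (z , zs , e₁ , e₂) = inj₂ (z , zs , cong (x ∷_) e₁ , e₂)

module _ {A : Set} where

  toList-injective : {ν ν' : List⁺ A} → toList ν ≡ toList ν' → ν ≡ ν'
  toList-injective {_ ∷ _} refl = refl

  toList-++⁺ : (u : List A) (ν : List⁺ A) → toList (u ++⁺ ν) ≡ u ++ toList ν
  toList-++⁺ [] ν = refl
  toList-++⁺ (a ∷ u) ν = cong (a ∷_) (toList-++⁺ u ν)

  head-++⁺-cong : (u : List A) {ν ν' : List⁺ A} → head ν ≡ head ν' →
    head (u ++⁺ ν) ≡ head (u ++⁺ ν')
  head-++⁺-cong [] e = e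
  head-++⁺-cong (a ∷ u) e = refl

  final-++⁺ : (u : List A) (ν : List⁺ A) → final (u ++⁺ ν) ≡ final ν
  final-++⁺ [] ν = refl
  final-++⁺ (a ∷ u) ν = final-++⁺ u ν

  finalL-++ : (x : A) (xs v : List A) → finalL x (xs ++ v) ≡ finalL (finalL x xs) v
  finalL-++ x [] v = refl
  finalL-++ x (y ∷ ys) v = finalL-++ y ys v

  final-⁺++ : (ν : List⁺ A) (v : List A) → final (ν ⁺++ v) ≡ finalL (final ν) v
  final-⁺++ (x ∷ xs) = finalL-++ x xs

  dropLastL-++-finalL : (x : A) (xs t : List A) →
    dropLastL x xs ++ finalL x xs ∷ t ≡ x ∷ xs ++ t
  dropLastL-++-finalL x [] t = refl
  dropLastL-++-finalL x (y ∷ ys) t = cong (x ∷_) (dropLastL-++-finalL y ys t)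

  ⋆-≡-⁺++ : (ρ σ : List⁺ A) → final ρ ≡ head σ → ρ ⋆ σ ≡ ρ ⁺++ tail σ
  ⋆-≡-⁺++ (x ∷ xs) (_ ∷ t) refl = toList-injective
    (trans (toList-++⁺ (dropLastL x xs) _) (dropLastL-++-finalL x xs t))

State : Setting → Set
State M = Fin (nS (K M))

module _ {M : Setting} where

  ProperPrefix-++⁺ : (u : List (State M)) {ν ρ : Word M} →
    ProperPrefix M ν ρ → ProperPrefix M (u ++⁺ ν) (u ++⁺ ρ)
  ProperPrefix-++⁺ u {ν} {ρ} (w , eq) = w , (begin
    toList (u ++⁺ ν) ++ toList w  ≡⟨ cong (_++ toList w) (toList-++⁺ u ν) ⟩
    (u ++ toList ν) ++ toList w   ≡⟨ ++-assoc u (toList ν) (toList w) ⟩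
    u ++ toList ν ++ toList w     ≡⟨ cong (u ++_) eq ⟩
    u ++ toList ρ                 ≡⟨ toList-++⁺ u ρ ⟨
    toList (u ++⁺ ρ)              ∎)
    where open ≡-Reasoning

  ProperPrefix-++⁺⁻ : (u : List (State M)) {ν ρ : Word M} →
    ProperPrefix M ν (u ++⁺ ρ) →
    (∀ ρ' → ProperPrefix M ν (u ++⁺ ρ')) ⊎
    (Σ (Word M) λ ν₀ → ProperPrefix M ν₀ ρ × ν ≡ u ++⁺ ν₀)
  ProperPrefix-++⁺⁻ u {ν} {ρ} (w , eq)
    with ++-≡-++-split (toList ν) (toList w) u (toList ρ) (trans eq (toList-++⁺ u ρ))
  ... | inj₁ (m , u≡ν++m , _) = inj₁ λ ρ' → m ++⁺ ρ' , (begin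
    toList ν ++ toList (m ++⁺ ρ') ≡⟨ cong (toList ν ++_) (toList-++⁺ m ρ') ⟩
    toList ν ++ m ++ toList ρ'    ≡⟨ ++-assoc (toList ν) m (toList ρ') ⟨
    (toList ν ++ m) ++ toList ρ'  ≡⟨ cong (_++ toList ρ') u≡ν++m ⟨
    u ++ toList ρ'                ≡⟨ toList-++⁺ u ρ' ⟨
    toList (u ++⁺ ρ')             ∎)
    where open ≡-Reasoning
  ... | inj₂ (y , ys , ν≡u++ν₀ , ρ≡ν₀++w) = inj₂ (y ∷ ys , (w , sym ρ≡ν₀++w) ,
    toList-injective (trans ν≡u++ν₀ (sym (toList-++⁺ u (y ∷ ys)))))

  ProperPrefix-⁺++ : (v : List (State M)) {ν ρ : Word M} →
    ProperPrefix M ν ρ → ProperPrefix M ν (ρ ⁺++ v)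
  ProperPrefix-⁺++ v {ν} (w , eq) = w ⁺++ v ,
    trans (sym (++-assoc (toList ν) (toList w) v)) (cong (_++ v) eq)

  ProperPrefix-⁺++⁻ : (v : List (State M)) {ν ρ : Word M} →
    ProperPrefix M ν (ρ ⁺++ v) →
    ProperPrefix M ν ρ ⊎
    (Σ (List (State M)) λ m → ν ≡ ρ ⁺++ m × (∀ ρ' → ProperPrefix M (ρ' ⁺++ m) (ρ' ⁺++ v)))
  ProperPrefix-⁺++⁻ v {ν} {ρ} (w , eq)
    with ++-≡-++-split (toList ρ) v (toList ν) (toList w) (sym eq)
  ... | inj₁ (m , ν≡ρ++m , v≡m++w) = inj₂ (m , toList-injective ν≡ρ++m ,
    λ ρ' → w , trans (++-assoc (toList ρ') m (toList w)) (cong (toList ρ' ++_) (sym v≡m++w)))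
  ... | inj₂ (y , ys , ρ≡ν++w₀ , _) = inj₁ (y ∷ ys , sym ρ≡ν++w₀)

  -- PBisim M (suc h) ρ ρ' unfolds to SameSummary M ρ ρ' × Forth (PBisim M h) ρ ρ' × Forth (flip (PBisim M h)) ρ' ρ.
  Forth : (Word M → Word M → Set) → Word M → Word M → Set
  Forth B ρ ρ' = ∀ ν → ProperPrefix M ν ρ → Σ (Word M) λ ν' → ProperPrefix M ν' ρ' × B ν ν'

  Forth-++⁺ : {B : Word M → Word M → Set} (u : List (State M)) {ρ ρ' : Word M} →
    (∀ ν → B ν ν) → (∀ {ν ν'} → B ν ν' → B (u ++⁺ ν) (u ++⁺ ν')) →
    Forth B ρ ρ' → Forth B (u ++⁺ ρ) (u ++⁺ ρ')
  Forth-++⁺ u {ρ' = ρ'} B-refl B-++⁺ f ν p with ProperPrefix-++⁺⁻ u p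
  ... | inj₁ ν⊏u++ = ν , ν⊏u++ ρ' , B-refl ν
  ... | inj₂ (ν₀ , p₀ , refl) =
    let ν₀' , p₀' , b = f ν₀ p₀ in u ++⁺ ν₀' , ProperPrefix-++⁺ u p₀' , B-++⁺ b

  Forth-⁺++ : {B : Word M → Word M → Set} (v : List (State M)) {ρ ρ' : Word M} →
    (∀ m → B (ρ ⁺++ m) (ρ' ⁺++ m)) →
    Forth B ρ ρ' → Forth B (ρ ⁺++ v) (ρ' ⁺++ v)
  Forth-⁺++ v {ρ' = ρ'} B-⁺++ f ν p with ProperPrefix-⁺++⁻ v p
  ... | inj₁ p₀ = let ν' , p' , b = f ν p₀ in ν' , ProperPrefix-⁺++ v p' , b
  ... | inj₂ (m , refl , ρ'm⊏ρ'v) = ρ' ⁺++ m , ρ'm⊏ρ'v ρ' , B-⁺++ m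

  μword-++⁺ : (u : List (State M)) (ν : Word M) →
    μword M (u ++⁺ ν) ≡ map (μ (K M)) u ++ μword M ν
  μword-++⁺ u ν = trans (cong (map (μ (K M))) (toList-++⁺ u ν)) (map-++ (μ (K M)) u (toList ν))

  μword-⁺++ : (ν : Word M) (v : List (State M)) →
    μword M (ν ⁺++ v) ≡ μword M ν ++ map (μ (K M)) v
  μword-⁺++ ν = map-++ (μ (K M)) (toList ν)

  SameSummary-++⁺ : (u : List (State M)) {ν ν' : Word M} →
    SameSummary M ν ν' → SameSummary M (u ++⁺ ν) (u ++⁺ ν')
  SameSummary-++⁺ u {ν} {ν'} (same-head , same-final , same-Π) =
    head-++⁺-cong u same-head ,
    trans (final-++⁺ u ν) (trans same-final (sym (final-++⁺ u ν'))) ,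
    λ ℓ → subst₂ (RunEquivalent (aut M ℓ)) (sym (μword-++⁺ u ν)) (sym (μword-++⁺ u ν'))
            (RunEquivalent-++ (aut M ℓ) (RunEquivalent-refl (aut M ℓ) _) (same-Π ℓ))

  SameSummary-⁺++ : (v : List (State M)) {ν ν' : Word M} →
    SameSummary M ν ν' → SameSummary M (ν ⁺++ v) (ν' ⁺++ v)
  SameSummary-⁺++ v {ν} {ν'} (same-head , same-final , same-Π) =
    same-head ,
    trans (final-⁺++ ν v) (trans (cong (λ s → finalL s v) same-final) (sym (final-⁺++ ν' v))) ,
    λ ℓ → subst₂ (RunEquivalent (aut M ℓ)) (sym (μword-⁺++ ν v)) (sym (μword-⁺++ ν' v))
            (RunEquivalent-++ (aut M ℓ) (same-Π ℓ) (RunEquivalent-refl (aut M ℓ) _))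

  PBisim⇒SameSummary : ∀ h {ν ν' : Word M} → PBisim M h ν ν' → SameSummary M ν ν'
  PBisim⇒SameSummary zero s = s
  PBisim⇒SameSummary (suc h) (s , _) = s

  PBisim-refl : ∀ h (ν : Word M) → PBisim M h ν ν
  PBisim-refl zero ν = refl , refl , λ ℓ → RunEquivalent-refl (aut M ℓ) _
  PBisim-refl (suc h) ν =
    PBisim-refl zero ν , (λ ν₀ p → ν₀ , p , PBisim-refl h ν₀) , (λ ν₀ p → ν₀ , p , PBisim-refl h ν₀)

  PBisim-pred : ∀ h {ν ν' : Word M} → PBisim M (suc h) ν ν' → PBisim M h ν ν'
  PBisim-pred zero (s , _) = s
  PBisim-pred (suc h) (s , f , g) = s ,
    (λ ν₀ p → let ν₀' , p' , b = f ν₀ p in ν₀' , p' , PBisim-pred h b) ,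
    (λ ν₀ p → let ν₀' , p' , b = g ν₀ p in ν₀' , p' , PBisim-pred h b)

  PBisim-++⁺ : ∀ h (u : List (State M)) {ν ν' : Word M} →
    PBisim M h ν ν' → PBisim M h (u ++⁺ ν) (u ++⁺ ν')
  PBisim-++⁺ zero u s = SameSummary-++⁺ u s
  PBisim-++⁺ (suc h) u (s , f , g) = SameSummary-++⁺ u s ,
    Forth-++⁺ u (PBisim-refl h) (PBisim-++⁺ h u) f ,
    Forth-++⁺ u (PBisim-refl h) (PBisim-++⁺ h u) g

  PBisim-⁺++ : ∀ h (v : List (State M)) {ν ν' : Word M} →
    PBisim M h ν ν' → PBisim M h (ν ⁺++ v) (ν' ⁺++ v)
  PBisim-⁺++ zero v s = SameSummary-⁺++ v s
  PBisim-⁺++ (suc h) v P@(s , f , g) = SameSummary-⁺++ v s ,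
    Forth-⁺++ v (λ m → PBisim-⁺++ h m (PBisim-pred h P)) f ,
    Forth-⁺++ v (λ m → PBisim-⁺++ h m (PBisim-pred h P)) g

proposition2 : (M : Setting) (h : ℕ) (ρ ρ' : Word M) →
    IsTrace M ρ → IsTrace M ρ' → PBisim M h ρ ρ' →
    (ρL ρR : Word M) → IsTrace M ρL → IsTrace M ρR →
    final ρL ≡ head ρ → final ρ ≡ head ρR →
    PBisim M h (ρL ⋆ ρ) (ρL ⋆ ρ') × PBisim M h (ρ ⋆ ρR) (ρ' ⋆ ρR)
proposition2 M h ρ ρ' _ _ ρ∼ρ' ρL ρR _ _ _ ρ↝ρR =
  PBisim-++⁺ h (dropLast ρL) ρ∼ρ' ,
  subst₂ (PBisim M h) (sym (⋆-≡-⁺++ ρ ρR ρ↝ρR)) (sym (⋆-≡-⁺++ ρ' ρR ρ'↝ρR))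
    (PBisim-⁺++ h (tail ρR) ρ∼ρ')
  where
  ρ'↝ρR : final ρ' ≡ head ρR
  ρ'↝ρR with _ , same-final , _ ← PBisim⇒SameSummary h ρ∼ρ' = trans (sym same-final) ρ↝ρR
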